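{- Let $1 \to H \to G \xrightarrow{\phi} K \to 1$ be a short exact sequence of finite groups. Then $d(G) \le (d(H)-1) f(K) + d(K)$. Further, if equality holds, then $f(G) \le f(H) f(K)$.
   Context: For a finite group $G$ (written multiplicatively): a sequence in $G$ is a tuple $S=(a_1,\dots,a_n)$ of elements of $G$ (repetition allowed); a subsequence is obtained by choosing a nonempty subset of the index set. $S$ is a product-one sequence if $a_{\sigma(1)}\cdots a_{\sigma(n)}=1$ for some permutation $\sigma$. The Davenport constant $d(G)$ is the smallest positive integer $m$ such that every sequence in $G$ of length $m$ has a product-one subsequence. $f(G)$ is the smallest positive integer $m$ such that every sequence in $G$ of length $d(G)$ has a product-one subsequence of length at most $m$. -}

module Defs where

open import Level using (Level; _⊔_)
open import Data.Nat using (ℕ; _≤_; _<_)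
open import Data.Fin using (Fin)
open import Data.List using (List; []; map; foldr; length)
open import Data.List.Relation.Unary.Unique.Propositional using (Unique)
open import Data.Product using (Σ; ∃; _×_)
open import Relation.Binary.PropositionalEquality using (_≢_)
open import Algebra.Bundles using (Group)
open import Algebra.Morphism.Structures using (module GroupMorphisms)

record FiniteGroup (c ℓ : Level) : Set (Level.suc (c ⊔ ℓ)) where
  field
    group     : Group c ℓ
  open Group group public
  field
    size      : ℕ
    enum      : Fin size → Carrier
    enum-surj : ∀ x → ∃ λ i → enum i ≈ x

module _ {c ℓ : Level} (G : FiniteGroup c ℓ) where
  open FiniteGroup G

  prod : List Carrier → Carrier
  prod = foldr _∙_ ε

  -- A product-one subsequence of S = (a_1,...,a_n), together with an ordering
  -- of it: a nonempty list of pairwise distinct indices whose ordered product is 1.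
  -- (Choosing a nonempty index set and a permutation of it = such a list.)
  ProdOneSubseqOfLength≤ : {n : ℕ} → (Fin n → Carrier) → ℕ → Set ℓ
  ProdOneSubseqOfLength≤ {n} a m =
    Σ (List (Fin n)) λ is → (is ≢ []) × Unique is × (length is ≤ m)
      × (prod (map a is) ≈ ε)

  HasProdOneSubseq : {n : ℕ} → (Fin n → Carrier) → Set ℓ
  HasProdOneSubseq {n} a =
    Σ (List (Fin n)) λ is → (is ≢ []) × Unique is × (prod (map a is) ≈ ε)

  DavProp : ℕ → Set (c ⊔ ℓ)
  DavProp m = (a : Fin m → Carrier) → HasProdOneSubseq a

  IsDavenport : ℕ → Set (c ⊔ ℓ)
  IsDavenport m = (0 < m) × DavProp m × (∀ k → 0 < k → DavProp k → m ≤ k)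

  FProp : ℕ → ℕ → Set (c ⊔ ℓ)
  FProp d m = (a : Fin d → Carrier) → ProdOneSubseqOfLength≤ a m

  IsF : ℕ → Set (c ⊔ ℓ)
  IsF m = Σ ℕ λ d → IsDavenport d × (0 < m) × FProp d m
            × (∀ k → 0 < k → FProp d k → m ≤ k)

record ShortExact {c ℓ : Level} (H G K : FiniteGroup c ℓ) : Set (c ⊔ ℓ) where
  private
    module H = FiniteGroup H
    module G = FiniteGroup G
    module K = FiniteGroup K
  open GroupMorphisms
  field
    ι      : H.Carrier → G.Carrier
    ι-mono : IsGroupMonomorphism H.rawGroup G.rawGroup ι
    φ      : G.Carrier → K.Carrier
    φ-hom  : IsGroupHomomorphism G.rawGroup K.rawGroup φ
    φ-surj : ∀ y → ∃ λ x → φ x K.≈ y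
    exact₁ : ∀ h → φ (ι h) K.≈ K.ε
    exact₂ : ∀ g → φ g K.≈ K.ε → ∃ λ h → ι h G.≈ g

-- Let a be a sequence in G of length (d(H) - 1) f(K) + d(K).  Its image under φ
-- contains d(H) pairwise disjoint product-one subsequences ("blocks") of length at
-- most f(K): extract one, delete its terms, and repeat; at least d(K) terms remain
-- before each extraction.  The block products lie in ker φ = H and so form a
-- sequence of length d(H) in H, which has a product-one subsequence, of length at
-- most f(H).  Concatenating the corresponding blocks gives a product-one
-- subsequence of a, of length at most f(H) f(K).  Hence d(G) is at most the
-- length of a, and when it is equal to it, f(G) ≤ f(H) f(K).

module Submission where

open import Defs
open import Level using (Level)
open import Data.Nat using (ℕ; zero; suc; _≤_; _<_; _+_; _*_; _∸_; s≤s; z≤n)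
open import Data.Nat.Properties
  using (≤-refl; ≤-trans; ≤-reflexive; ≤-antisym; +-identityʳ; +-suc; +-assoc; +-comm;
         +-cancelˡ-≤; +-monoʳ-≤; +-mono-≤; m≤n+m; *-monoˡ-≤; *-mono-<)
open import Data.Fin using (Fin; punchIn; punchOut; inject≤) renaming (zero to fzero; suc to fsuc)
open import Data.Fin.Properties
  using (punchIn-injective; punchInᵢ≢i; punchOut-cong; punchOut-punchIn; punchOut-injective;
         inject≤-injective)
open import Data.List using (List; []; _∷_; map; length; _++_; concatMap)
open import Data.List.Properties using (length-map; length-++; map-∘)
open import Data.List.Relation.Unary.All using (All; []; _∷_)
import Data.List.Relation.Unary.All as All
import Data.List.Relation.Unary.All.Properties as All
open import Data.List.Relation.Unary.AllPairs as AllPairs using ([]; _∷_)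
import Data.List.Relation.Unary.AllPairs.Properties as AllPairs
open import Data.List.Relation.Unary.Any using (here; there)
open import Data.List.Relation.Unary.Unique.Propositional using (Unique)
import Data.List.Relation.Unary.Unique.Propositional.Properties as Unique
open import Data.List.Relation.Binary.Disjoint.Propositional using (Disjoint)
open import Data.List.Membership.Propositional using (_∈_; _∉_)
open import Data.List.Membership.Propositional.Properties using (∈-map⁻)
open import Data.Product using (_×_; _,_; proj₁; proj₂)
open import Data.Empty using (⊥-elim)
open import Function using (_∘_)
open import Function.Definitions using (Injective)
open import Relation.Binary.PropositionalEquality as ≡ using (_≡_; _≢_; refl; cong; subst)
open import Algebra.Morphism.Structures using (module GroupMorphisms)

open GroupMorphisms using (IsGroupHomomorphism)

punchOutAll : ∀ {n} (x : Fin (suc n)) (ys : List (Fin (suc n))) → All (x ≢_) ys → List (Fin n)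
punchOutAll x []       []         = []
punchOutAll x (y ∷ ys) (x≢y ∷ ps) = punchOut x≢y ∷ punchOutAll x ys ps

length-punchOutAll : ∀ {n} x ys ps → length (punchOutAll {n} x ys ps) ≡ length ys
length-punchOutAll x []       []       = refl
length-punchOutAll x (y ∷ ys) (_ ∷ ps) = cong suc (length-punchOutAll x ys ps)

punchOutAll-≢ : ∀ {n} x {y} (x≢y : x ≢ y) ys ps →
  All (y ≢_) ys → All (punchOut x≢y ≢_) (punchOutAll {n} x ys ps)
punchOutAll-≢ x x≢y []       []         []           = []
punchOutAll-≢ x x≢y (z ∷ zs) (x≢z ∷ ps) (y≢z ∷ y≢zs) =
  (y≢z ∘ punchOut-injective x≢y x≢z) ∷ punchOutAll-≢ x x≢y zs ps y≢zs

punchOutAll-unique : ∀ {n} x ys ps → Unique ys → Unique (punchOutAll {n} x ys ps)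
punchOutAll-unique x []       []         []           = []
punchOutAll-unique x (y ∷ ys) (x≢y ∷ ps) (y∉ys ∷ ys!) =
  punchOutAll-≢ x x≢y ys ps y∉ys ∷ punchOutAll-unique x ys ps ys!

punchIn∈⇒∈punchOutAll : ∀ {n} x z ys ps → punchIn x z ∈ ys → z ∈ punchOutAll {n} x ys ps
punchIn∈⇒∈punchOutAll x z (y ∷ ys) (_ ∷ ps) (here refl) =
  here (≡.sym (≡.trans (punchOut-cong x refl) (punchOut-punchIn x)))
punchIn∈⇒∈punchOutAll x z (y ∷ ys) (_ ∷ ps) (there z∈ys) =
  there (punchIn∈⇒∈punchOutAll x z ys ps z∈ys)

record Complement (n : ℕ) (xs : List (Fin n)) : Set where
  field
    size            : ℕ
    size-bound      : n ≤ size + length xs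
    embed           : Fin size → Fin n
    embed-injective : Injective _≡_ _≡_ embed
    embed-∉         : ∀ i → embed i ∉ xs

complement : ∀ n (xs : List (Fin n)) → Unique xs → Complement n xs
complement n [] _ = record
  { size = n ; size-bound = ≤-reflexive (≡.sym (+-identityʳ n))
  ; embed = λ i → i ; embed-injective = λ e → e ; embed-∉ = λ _ () }
complement zero    (() ∷ _)
complement (suc n) (x ∷ xs) (x∉xs ∷ xs!) = record
  { size            = C.size
  ; size-bound      = size-bound
  ; embed           = punchIn x ∘ C.embed
  ; embed-injective = C.embed-injective ∘ punchIn-injective x _ _
  ; embed-∉         = embed-∉ }
  where
  module C = Complement (complement n (punchOutAll x xs x∉xs) (punchOutAll-unique x xs x∉xs xs!))

  size-bound : suc n ≤ C.size + suc (length xs)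
  size-bound = subst (suc n ≤_) (≡.sym (+-suc C.size (length xs)))
    (s≤s (subst (λ l → n ≤ C.size + l) (length-punchOutAll x xs x∉xs) C.size-bound))

  embed-∉ : ∀ i → punchIn x (C.embed i) ∉ x ∷ xs
  embed-∉ i (here e)  = punchInᵢ≢i x (C.embed i) e
  embed-∉ i (there m) = C.embed-∉ i (punchIn∈⇒∈punchOutAll x (C.embed i) xs x∉xs m)

module _ {A B : Set} (T : A → List B) where

  concatMap-≢[] : (∀ x → T x ≢ []) → ∀ xs → xs ≢ [] → concatMap T xs ≢ []
  concatMap-≢[] T≢[] []       []≢[] = λ _ → []≢[] refl
  concatMap-≢[] T≢[] (x ∷ xs) _     = ++-≢[] (T x) (T≢[] x)
    where
    ++-≢[] : ∀ ys → ys ≢ [] → ys ++ concatMap T xs ≢ []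
    ++-≢[] []      ys≢[] = λ _ → ys≢[] refl
    ++-≢[] (_ ∷ _) _     = λ ()

  length-concatMap-≤ : ∀ {L} → (∀ x → length (T x) ≤ L) → ∀ xs → length (concatMap T xs) ≤ length xs * L
  length-concatMap-≤ T≤L []       = z≤n
  length-concatMap-≤ T≤L (x ∷ xs) =
    ≤-trans (≤-reflexive (length-++ (T x))) (+-mono-≤ (T≤L x) (length-concatMap-≤ T≤L xs))

  concatMap-unique : (∀ x → Unique (T x)) → (∀ {x x'} → x ≢ x' → Disjoint (T x) (T x')) →
    ∀ {xs} → Unique xs → Unique (concatMap T xs)
  concatMap-unique T! T# {xs} xs! =
    Unique.concat⁺ (All.map⁺ (All.universal T! xs)) (AllPairs.map⁺ (AllPairs.map T# xs!))

module _ {c ℓ} (X : FiniteGroup c ℓ) where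
  open FiniteGroup X renaming (refl to ≈-refl)

  prod-++ : ∀ {A : Set} (a : A → Carrier) xs ys →
    prod X (map a (xs ++ ys)) ≈ prod X (map a xs) ∙ prod X (map a ys)
  prod-++ a []       ys = sym (identityˡ _)
  prod-++ a (x ∷ xs) ys = trans (∙-congˡ (prod-++ a xs ys)) (sym (assoc _ _ _))

  prod-cong : ∀ {A : Set} {a b : A → Carrier} → (∀ x → a x ≈ b x) → ∀ xs →
    prod X (map a xs) ≈ prod X (map b xs)
  prod-cong a≈b []       = ≈-refl
  prod-cong a≈b (x ∷ xs) = ∙-cong (a≈b x) (prod-cong a≈b xs)

  prod-concatMap : ∀ {A B : Set} (a : B → Carrier) (T : A → List B) xs →
    prod X (map a (concatMap T xs)) ≈ prod X (map (λ x → prod X (map a (T x))) xs)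
  prod-concatMap a T []       = ≈-refl
  prod-concatMap a T (x ∷ xs) = trans (prod-++ a (T x) (concatMap T xs)) (∙-congˡ (prod-concatMap a T xs))

module _ {c ℓ} (X Y : FiniteGroup c ℓ) {f : FiniteGroup.Carrier X → FiniteGroup.Carrier Y}
  (f-hom : IsGroupHomomorphism (FiniteGroup.rawGroup X) (FiniteGroup.rawGroup Y) f) where
  open FiniteGroup Y
  open IsGroupHomomorphism f-hom

  prod-homo : ∀ {A : Set} (a : A → FiniteGroup.Carrier X) xs →
    f (prod X (map a xs)) ≈ prod Y (map (f ∘ a) xs)
  prod-homo a []       = ε-homo
  prod-homo a (x ∷ xs) = trans (homo _ _) (∙-congˡ (prod-homo a xs))

module _ {c ℓ} (X : FiniteGroup c ℓ) where
  open FiniteGroup X hiding (refl)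

  reindex : ∀ {m m' f} {b : Fin m → Carrier} (g : Fin m' → Fin m) → Injective _≡_ _≡_ g →
    ProdOneSubseqOfLength≤ X (b ∘ g) f → ProdOneSubseqOfLength≤ X b f
  reindex {f = f} {b} g g-inj (is , is≢[] , is! , |is|≤f , ∏≈ε) =
    map g is , (is≢[] ∘ map-≡[]) , Unique.map⁺ g-inj is! ,
    subst (_≤ f) (≡.sym (length-map g is)) |is|≤f ,
    trans (reflexive (cong (prod X) (≡.sym (map-∘ is)))) ∏≈ε
    where
    map-≡[] : ∀ {xs} → map g xs ≡ [] → xs ≡ []
    map-≡[] {[]} _ = refl

  FProp⇒ProdOneSubseq : ∀ {d f m} → FProp X d f → d ≤ m → (b : Fin m → Carrier) →
    ProdOneSubseqOfLength≤ X b f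
  FProp⇒ProdOneSubseq fp d≤m b =
    reindex (λ i → inject≤ i d≤m) (inject≤-injective d≤m d≤m _ _) (fp (λ i → b (inject≤ i d≤m)))

  davenport-unique : ∀ {d d'} → IsDavenport X d → IsDavenport X d' → d ≡ d'
  davenport-unique (d>0 , dav , min) (d'>0 , dav' , min') = ≤-antisym (min _ d'>0 dav') (min' _ d>0 dav)

  IsF⇒FProp : ∀ {d f} → IsDavenport X d → IsF X f → FProp X d f
  IsF⇒FProp isD (_ , isD' , _ , fp , _) = subst (λ e → FProp X e _) (davenport-unique isD' isD) fp

  IsF-minimal : ∀ {d f k} → IsDavenport X d → IsF X f → 0 < k → FProp X d k → f ≤ k
  IsF-minimal isD (_ , isD' , _ , _ , min) k>0 fp =
    min _ k>0 (subst (λ e → FProp X e _) (davenport-unique isD isD') fp)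

  record DisjointBlocks {m : ℕ} (b : Fin m → Carrier) (f r : ℕ) : Set ℓ where
    field
      block    : Fin r → ProdOneSubseqOfLength≤ X b f
      disjoint : ∀ {i i' x} → x ∈ proj₁ (block i) → x ∈ proj₁ (block i') → i ≡ i'

    indices : Fin r → List (Fin m)
    indices = proj₁ ∘ block

    indices-≢[] : ∀ i → indices i ≢ []
    indices-≢[] = proj₁ ∘ proj₂ ∘ block

    indices-unique : ∀ i → Unique (indices i)
    indices-unique = proj₁ ∘ proj₂ ∘ proj₂ ∘ block

    length-indices : ∀ i → length (indices i) ≤ f
    length-indices = proj₁ ∘ proj₂ ∘ proj₂ ∘ proj₂ ∘ block

    prod-indices : ∀ i → prod X (map b (indices i)) ≈ ε
    prod-indices = proj₂ ∘ proj₂ ∘ proj₂ ∘ proj₂ ∘ block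

  disjointBlocks : ∀ {d f} → FProp X d f → ∀ j {m} → j * f + d ≤ m → (b : Fin m → Carrier) →
    DisjointBlocks b f (suc j)
  disjointBlocks fp zero d≤m b = record
    { block = λ _ → FProp⇒ProdOneSubseq fp d≤m b ; disjoint = λ { {fzero} {fzero} _ _ → refl } }
  disjointBlocks {d} {f} fp (suc j) {m} bound b = record { block = block ; disjoint = disjoint }
    where
    first : ProdOneSubseqOfLength≤ X b f
    first = FProp⇒ProdOneSubseq fp (≤-trans (m≤n+m d (suc j * f)) bound) b

    module C = Complement (complement m (proj₁ first) (proj₁ (proj₂ (proj₂ first))))

    remaining-bound : j * f + d ≤ C.size
    remaining-bound = +-cancelˡ-≤ f _ _ (begin
      f + (j * f + d)               ≡⟨ ≡.sym (+-assoc f (j * f) d) ⟩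
      suc j * f + d                 ≤⟨ bound ⟩
      m                             ≤⟨ C.size-bound ⟩
      C.size + length (proj₁ first) ≤⟨ +-monoʳ-≤ C.size (proj₁ (proj₂ (proj₂ (proj₂ first)))) ⟩
      C.size + f                    ≡⟨ +-comm C.size f ⟩
      f + C.size                    ∎)
      where open Data.Nat.Properties.≤-Reasoning

    module Rest = DisjointBlocks (disjointBlocks fp j remaining-bound (b ∘ C.embed))

    block : Fin (suc (suc j)) → ProdOneSubseqOfLength≤ X b f
    block fzero    = first
    block (fsuc i) = reindex C.embed C.embed-injective (Rest.block i)

    disjoint : ∀ {i i' x} → x ∈ proj₁ (block i) → x ∈ proj₁ (block i') → i ≡ i'
    disjoint {fzero}  {fzero}   _  _ = refl
    disjoint {fzero}  {fsuc _} x∈ x∈' with ∈-map⁻ C.embed x∈'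
    ... | y , _ , refl = ⊥-elim (C.embed-∉ y x∈)
    disjoint {fsuc _} {fzero}  x∈ x∈' with ∈-map⁻ C.embed x∈
    ... | y , _ , refl = ⊥-elim (C.embed-∉ y x∈')
    disjoint {fsuc _} {fsuc _} x∈ x∈' with ∈-map⁻ C.embed x∈ | ∈-map⁻ C.embed x∈'
    ... | y , y∈ , e | z , z∈ , e' =
      cong fsuc (Rest.disjoint y∈ (subst (_∈ _) (C.embed-injective (≡.trans (≡.sym e') e)) z∈))

module _ {c ℓ} {H G K : FiniteGroup c ℓ} (SE : ShortExact H G K) where
  private
    module H = FiniteGroup H
    module G = FiniteGroup G
    module K = FiniteGroup K
  open ShortExact SE
  open GroupMorphisms.IsGroupMonomorphism ι-mono using (isGroupHomomorphism; ⟦⟧-cong; ε-homo)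

  module LiftBlocks {n r f} {a : Fin n → G.Carrier} (B : DisjointBlocks K (φ ∘ a) f r) where
    open DisjointBlocks B

    prod-indices∈ker : ∀ i → φ (prod G (map a (indices i))) K.≈ K.ε
    prod-indices∈ker i = K.trans (prod-homo G K φ-hom a (indices i)) (prod-indices i)

    lift : Fin r → H.Carrier
    lift i = proj₁ (exact₂ _ (prod-indices∈ker i))

    ι-lift : ∀ i → ι (lift i) G.≈ prod G (map a (indices i))
    ι-lift i = proj₂ (exact₂ _ (prod-indices∈ker i))

    concatBlocks : ∀ {m} → ProdOneSubseqOfLength≤ H lift m → ProdOneSubseqOfLength≤ G a (m * f)
    concatBlocks (js , js≢[] , js! , |js|≤m , ∏≈ε) =
      concatMap indices js ,
      concatMap-≢[] indices indices-≢[] js js≢[] ,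
      concatMap-unique indices indices-unique (λ i≢i' (x∈ , x∈') → i≢i' (disjoint x∈ x∈')) js! ,
      ≤-trans (length-concatMap-≤ indices length-indices js) (*-monoˡ-≤ f |js|≤m) ,
      prod-concat
      where
      open import Relation.Binary.Reasoning.Setoid G.setoid

      prod-concat : prod G (map a (concatMap indices js)) G.≈ G.ε
      prod-concat = begin
        prod G (map a (concatMap indices js))              ≈⟨ prod-concatMap G a indices js ⟩
        prod G (map (λ i → prod G (map a (indices i))) js) ≈⟨ prod-cong G ι-lift js ⟨
        prod G (map (ι ∘ lift) js)                         ≈⟨ prod-homo H G isGroupHomomorphism lift js ⟨
        ι (prod H (map lift js))                           ≈⟨ ⟦⟧-cong ∏≈ε ⟩
        ι H.ε                                              ≈⟨ ε-homo ⟩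
        G.ε                                                ∎

  davProp-extension : ∀ {n r f} → DavProp H r → ((b : Fin n → K.Carrier) → DisjointBlocks K b f r) →
    DavProp G n
  davProp-extension davH blocks a
    with js , js≢[] , js! , ∏≈ε ← davH (LiftBlocks.lift (blocks (φ ∘ a)))
    with is , is≢[] , is! , _ , ∏'≈ε ← LiftBlocks.concatBlocks (blocks (φ ∘ a)) (js , js≢[] , js! , ≤-refl , ∏≈ε)
    = is , is≢[] , is! , ∏'≈ε

  fProp-extension : ∀ {n r f fH} → FProp H r fH → ((b : Fin n → K.Carrier) → DisjointBlocks K b f r) →
    FProp G n (fH * f)
  fProp-extension fpH blocks a = LiftBlocks.concatBlocks (blocks (φ ∘ a)) (fpH _)

proposition1p8 : {c ℓ : Level} (H G K : FiniteGroup c ℓ) → ShortExact H G K →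
    (dH dG dK fH fG fK : ℕ) →
    IsDavenport H dH → IsDavenport G dG → IsDavenport K dK →
    IsF H fH → IsF G fG → IsF K fK →
    (dG ≤ (dH ∸ 1) * fK + dK) × (dG ≡ (dH ∸ 1) * fK + dK → fG ≤ fH * fK)
proposition1p8 H G K SE zero    dG dK fH fG fK (() , _) _ _ _ _ _
proposition1p8 H G K SE (suc j) dG dK fH fG fK
  isH@(_ , davH , _) isG@(_ , _ , minG) isK@(dK>0 , _ , _)
  isFH@(_ , _ , fH>0 , _) isFG isFK@(_ , _ , fK>0 , _) = dG≤N , fG≤fHfK
  where
  N : ℕ
  N = j * fK + dK

  blocks : (b : Fin N → FiniteGroup.Carrier K) → DisjointBlocks K b fK (suc j)
  blocks = disjointBlocks K (IsF⇒FProp K isK isFK) j ≤-refl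

  dG≤N : dG ≤ N
  dG≤N = minG N (≤-trans dK>0 (m≤n+m dK (j * fK))) (davProp-extension SE davH blocks)

  fG≤fHfK : dG ≡ N → fG ≤ fH * fK
  fG≤fHfK dG≡N = IsF-minimal G (subst (IsDavenport G) dG≡N isG) isFG
    (*-mono-< fH>0 fK>0)
    (fProp-extension SE (IsF⇒FProp H isH isFH) blocks)
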